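{- Let $s,k$ be coprime positive integers with $s\ge2$. For all $x\in\mathcal{P}$, the number $x \bmod s$ is the first (i.e. the $<_{\mathcal{E}}$-least) element of $\langle x\rangle\cap\mathcal{E}$.
   Context: Let $\mathcal{P}=\mathbb{Z}_{>0}\setminus\{as+b(s+k) : a,b\in\mathbb{Z}_{\ge0}\}$, partially ordered by $<_{\mathcal{P}}$, the transitive closure of the relation $x\lessdot y$ iff $y-x\in\{s,s+k\}$. For $x\in\mathcal{P}$, $\langle x\rangle=\{y\in\mathcal{P}: y=x \text{ or } y<_{\mathcal{P}}x\}$. Let $\mathcal{E}=\mathcal{P}\cap\{1,\dots,s+k-1\}$, totally ordered by $<_{\mathcal{E}}$, the transitive closure of the relation $x\lessdot_{\mathcal{E}}y$ iff $y=x+s$ or $y=x-k$ (for $x,y\in\mathcal{E}$). Here $x\bmod s$ is the remainder of Euclidean division of $x$ by $s$. -}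

module Defs where

open import Data.Nat using (ℕ; _+_; _*_; _<_; _>_)
open import Data.Product using (_×_; ∃₂)
open import Data.Sum using (_⊎_)
open import Relation.Nullary using (¬_)
open import Relation.Binary.PropositionalEquality using (_≡_)
open import Relation.Binary.Construct.Closure.Transitive using (TransClosure)

InSemigroup : ℕ → ℕ → ℕ → Set
InSemigroup s k x = ∃₂ λ a b → x ≡ a * s + b * (s + k)

InP : ℕ → ℕ → ℕ → Set
InP s k x = x > 0 × ¬ InSemigroup s k x

CoverP : ℕ → ℕ → ℕ → ℕ → Set
CoverP s k x y = InP s k x × InP s k y × (y ≡ x + s ⊎ y ≡ x + (s + k))

_<P[_,_]_ : ℕ → ℕ → ℕ → ℕ → Set
x <P[ s , k ] y = TransClosure (CoverP s k) x y

-- y ∈ ⟨x⟩  (y ∈ 𝒫 and (y = x or y <_𝒫 x)); x is assumed in 𝒫 where used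
InDown : ℕ → ℕ → ℕ → ℕ → Set
InDown s k x y = InP s k y × (y ≡ x ⊎ y <P[ s , k ] x)

InE : ℕ → ℕ → ℕ → Set
InE s k y = InP s k y × y < s + k

-- x ⋖_ℰ y iff y = x + s or y = x - k (i.e. x = y + k), for x, y ∈ ℰ
CoverE : ℕ → ℕ → ℕ → ℕ → Set
CoverE s k x y = InE s k x × InE s k y × (y ≡ x + s ⊎ x ≡ y + k)

_<E[_,_]_ : ℕ → ℕ → ℕ → ℕ → Set
x <E[ s , k ] y = TransClosure (CoverE s k) x y

-- Euclidean remainder x mod s (the case s = 0 is irrelevant since s ≥ 2)
open import Data.Nat using (zero; suc; _%_)
_mod_ : ℕ → ℕ → ℕ
x mod zero = x
x mod suc n = x % suc n

{-# OPTIONS --safe #-}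
-- Since the semigroup S = ⟨s, s + k⟩ is closed under adding s, every number on
-- the chain x, x − s, …, x mod s is a gap, so r = x mod s lies below x in 𝒫 and,
-- being smaller than s, in ℰ. If y ∈ ⟨x⟩ ∩ ℰ then x − y ∈ S, which gives
-- y ≡ r + d·s (mod s + k) for some d with r + d·s a gap. The cover relation of
-- ℰ sends u to the representative of u + s modulo s + k (u ↦ u + s for u < k,
-- u ↦ u − k for u > k; u = k is excluded because k + s ∈ S), so d covering
-- steps in ℰ lead from r to y.
module Submission where

open import Defs
open import Data.Nat using (ℕ; _≤_; zero; suc; _+_; _*_; _∸_; _<_; _%_; _/_; NonZero)
open import Data.Nat.Properties
open import Data.Nat.DivMod using (m≡m%n+[m/n]*n; m%n<n; [m+kn]%n≡m%n; m<n⇒m%n≡m; [m∸n*o]/o≡m/o∸n)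
open import Data.Nat.Coprimality using (Coprime)
open import Algebra.Properties.CommutativeSemigroup +-commutativeSemigroup using (interchange; xy∙z≈xz∙y)
open import Data.Product using (_×_; _,_; ∃; proj₁; proj₂)
open import Data.Sum using (_⊎_; inj₁; inj₂)
open import Data.Empty using (⊥-elim)
open import Relation.Nullary using (¬_)
open import Relation.Binary.PropositionalEquality
open import Relation.Binary.Construct.Closure.Transitive using (TransClosure; [_]; _∷_)
open import Relation.Binary.Definitions using (tri<; tri≈; tri>)

_⁼ : {A : Set} → (A → A → Set) → A → A → Set
(R ⁼) u v = u ≡ v ⊎ TransClosure R u v

_◅⁼_ : {A : Set} {R : A → A → Set} {u w v : A} →
       R u w → (R ⁼) w v → (R ⁼) u v
r ◅⁼ inj₁ refl = inj₂ [ r ]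
r ◅⁼ inj₂ rs   = inj₂ (r ∷ rs)

m+n*d≡o⇒m≡o%d+[o/d∸n]*d : ∀ m n o {d} .{{_ : NonZero d}} →
                          m + n * d ≡ o → m ≡ o % d + (o / d ∸ n) * d
m+n*d≡o⇒m≡o%d+[o/d∸n]*d m n o {d} eq = begin
  m                      ≡⟨ m≡m%n+[m/n]*n m d ⟩
  m % d + (m / d) * d    ≡⟨ cong₂ (λ a b → a + b * d) m%d≡o%d m/d≡o/d∸n ⟩
  o % d + (o / d ∸ n) * d ∎
  where
  open ≡-Reasoning
  m%d≡o%d : m % d ≡ o % d
  m%d≡o%d = trans (sym ([m+kn]%n≡m%n m n d)) (cong (_% d) eq)
  m≡o∸n*d : m ≡ o ∸ n * d
  m≡o∸n*d = trans (sym (m+n∸n≡m m (n * d))) (cong (_∸ n * d) eq)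
  m/d≡o/d∸n : m / d ≡ o / d ∸ n
  m/d≡o/d∸n = trans (cong (_/ d) m≡o∸n*d) ([m∸n*o]/o≡m/o∸n o n d)

module Gaps (s k : ℕ) where

  Gap : ℕ → Set
  Gap z = ¬ InSemigroup s k z

  InSemigroup-+ : ∀ {z w} → InSemigroup s k z → InSemigroup s k w → InSemigroup s k (z + w)
  InSemigroup-+ (a , b , refl) (a′ , b′ , refl) = a + a′ , b + b′ , (begin
    (a * s + b * (s + k)) + (a′ * s + b′ * (s + k))
      ≡⟨ interchange (a * s) (b * (s + k)) (a′ * s) (b′ * (s + k)) ⟩
    (a * s + a′ * s) + (b * (s + k) + b′ * (s + k))
      ≡⟨ sym (cong₂ _+_ (*-distribʳ-+ s a a′) (*-distribʳ-+ (s + k) b b′)) ⟩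
    (a + a′) * s + (b + b′) * (s + k) ∎)
    where open ≡-Reasoning

  s∈S : InSemigroup s k s
  s∈S = 1 , 0 , sym (trans (+-identityʳ (s + 0)) (+-identityʳ s))

  s+k∈S : InSemigroup s k (s + k)
  s+k∈S = 0 , 1 , sym (+-identityʳ (s + k))

  *s∈S : ∀ n → InSemigroup s k (n * s)
  *s∈S n = n , 0 , sym (+-identityʳ (n * s))

  *[s+k]∈S : ∀ j → InSemigroup s k (j * (s + k))
  *[s+k]∈S j = 0 , j , refl

  Gap-cancelʳ : ∀ {z w} → InSemigroup s k w → Gap (z + w) → Gap z
  Gap-cancelʳ w∈S gap z∈S = gap (InSemigroup-+ z∈S w∈S)

  Gap⇒InP : ∀ {z} → Gap z → InP s k z
  Gap⇒InP gap = n≢0⇒n>0 (λ { refl → gap (0 , 0 , refl) }) , gap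

  u+[1+n]s≡u+s+ns : ∀ u n → u + suc n * s ≡ u + s + n * s
  u+[1+n]s≡u+s+ns u n = sym (+-assoc u s (n * s))

  +s-chain : ∀ n u → Gap (u + n * s) → (CoverP s k ⁼) u (u + n * s)
  +s-chain zero    u _   = inj₁ (sym (+-identityʳ u))
  +s-chain (suc n) u gap =
    subst ((CoverP s k ⁼) u) (sym (u+[1+n]s≡u+s+ns u n)) (cover ◅⁼ +s-chain n (u + s) gap′)
    where
    gap′ : Gap (u + s + n * s)
    gap′ = subst Gap (u+[1+n]s≡u+s+ns u n) gap
    cover : CoverP s k u (u + s)
    cover = Gap⇒InP (Gap-cancelʳ (*s∈S (suc n)) gap) , Gap⇒InP (Gap-cancelʳ (*s∈S n) gap′) , inj₁ refl

  ⋖P⇒difference∈S : ∀ {y x} → CoverP s k y x → ∃ λ d → InSemigroup s k d × x ≡ y + d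
  ⋖P⇒difference∈S (_ , _ , inj₁ refl) = s , s∈S , refl
  ⋖P⇒difference∈S (_ , _ , inj₂ refl) = s + k , s+k∈S , refl

  <P⇒difference∈S : ∀ {y x} → y <P[ s , k ] x → ∃ λ d → InSemigroup s k d × x ≡ y + d
  <P⇒difference∈S [ y⋖x ] = ⋖P⇒difference∈S y⋖x
  <P⇒difference∈S {y} (y⋖w ∷ w<x) with ⋖P⇒difference∈S y⋖w | <P⇒difference∈S w<x
  ... | d , d∈S , refl | e , e∈S , x≡w+e = d + e , InSemigroup-+ d∈S e∈S , trans x≡w+e (+-assoc y d e)

  ≼P⇒difference∈S : ∀ {y x} → (CoverP s k ⁼) y x → ∃ λ d → InSemigroup s k d × x ≡ y + d
  ≼P⇒difference∈S {y} (inj₁ refl) = 0 , (0 , 0 , refl) , sym (+-identityʳ y)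
  ≼P⇒difference∈S (inj₂ y<x)      = <P⇒difference∈S y<x

  infix 4 _↘_
  _↘_ : ℕ → ℕ → Set
  z ↘ w = ∃ λ j → z ≡ w + j * (s + k)

  ↘-refl : ∀ z → z ↘ z
  ↘-refl z = 0 , sym (+-identityʳ z)

  ↘-trans : ∀ {z w v} → z ↘ w → w ↘ v → z ↘ v
  ↘-trans {z} {w} {v} (i , z≡w+i) (j , w≡v+j) = j + i , (begin
    z                               ≡⟨ z≡w+i ⟩
    w + i * (s + k)                 ≡⟨ cong (_+ i * (s + k)) w≡v+j ⟩
    v + j * (s + k) + i * (s + k)   ≡⟨ +-assoc v _ _ ⟩
    v + (j * (s + k) + i * (s + k)) ≡⟨ cong (v +_) (sym (*-distribʳ-+ (s + k) j i)) ⟩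
    v + (j + i) * (s + k)           ∎)
    where open ≡-Reasoning

  ↘-+ʳ : ∀ {z w} c → z ↘ w → z + c ↘ w + c
  ↘-+ʳ {w = w} c (j , refl) = j , xy∙z≈xz∙y w (j * (s + k)) c

  Gap-↘ : ∀ {z w} → z ↘ w → Gap z → Gap w
  Gap-↘ (j , refl) = Gap-cancelʳ (*[s+k]∈S j)

  ↘⇒≡% : ∀ {z w} .{{_ : NonZero (s + k)}} → z ↘ w → w < s + k → w ≡ z % (s + k)
  ↘⇒≡% {w = w} (j , refl) w<s+k =
    trans (sym (m<n⇒m%n≡m w<s+k)) (sym ([m+kn]%n≡m%n w j (s + k)))

  ⋖E-+s : ∀ u → InE s k u → Gap (u + s) → ∃ λ u′ → CoverE s k u u′ × u + s ↘ u′
  ⋖E-+s u uE gap with <-cmp u k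
  ... | tri< u<k _ _ = u + s , (uE , u+sE , inj₁ refl) , ↘-refl (u + s)
    where
    u+sE : InE s k (u + s)
    u+sE = Gap⇒InP gap , subst (u + s <_) (+-comm k s) (+-monoˡ-< s u<k)
  ... | tri≈ _ refl _ = ⊥-elim (gap (subst (InSemigroup s k) (+-comm s k) s+k∈S))
  ... | tri> _ _ k<u = u ∸ k , (uE , u∸kE , inj₂ (sym u∸k+k≡u)) , u+s↘u∸k
    where
    u∸k+k≡u : u ∸ k + k ≡ u
    u∸k+k≡u = m∸n+n≡m (<⇒≤ k<u)
    u+s↘u∸k : u + s ↘ u ∸ k
    u+s↘u∸k = 1 , (begin
      u + s               ≡⟨ cong (_+ s) (sym u∸k+k≡u) ⟩
      u ∸ k + k + s       ≡⟨ +-assoc (u ∸ k) k s ⟩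
      u ∸ k + (k + s)     ≡⟨ cong (u ∸ k +_) (+-comm k s) ⟩
      u ∸ k + (s + k)     ≡⟨ cong (u ∸ k +_) (sym (+-identityʳ (s + k))) ⟩
      u ∸ k + 1 * (s + k) ∎)
      where open ≡-Reasoning
    u∸kE : InE s k (u ∸ k)
    u∸kE = Gap⇒InP (Gap-↘ u+s↘u∸k gap) , ≤-<-trans (m∸n≤m u k) (proj₂ uE)

  ≼E-walk : ∀ n u → InE s k u → Gap (u + n * s) →
            ∃ λ v → InE s k v × (CoverE s k ⁼) u v × u + n * s ↘ v
  ≼E-walk zero    u uE _   = u , uE , inj₁ refl , (0 , refl)
  ≼E-walk (suc n) u uE gap =
    let u′ , u⋖u′ , u+s↘u′ = ⋖E-+s u uE (Gap-cancelʳ (*s∈S n) gap′)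
        u+s+ns↘u′+ns = ↘-+ʳ (n * s) u+s↘u′
        v , vE , u′≼v , u′+ns↘v = ≼E-walk n u′ (proj₁ (proj₂ u⋖u′)) (Gap-↘ u+s+ns↘u′+ns gap′)
    in v , vE , u⋖u′ ◅⁼ u′≼v ,
       subst (_↘ v) (sym (u+[1+n]s≡u+s+ns u n)) (↘-trans u+s+ns↘u′+ns u′+ns↘v)
    where
    gap′ : Gap (u + s + n * s)
    gap′ = subst Gap (u+[1+n]s≡u+s+ns u n) gap

  ≼E-reach : ∀ n u y .{{_ : NonZero (s + k)}} → InE s k u → y < s + k →
             Gap (u + n * s) → u + n * s ↘ y → (CoverE s k ⁼) u y
  ≼E-reach n u y uE y<s+k gap z↘y =
    let v , vE , u≼v , z↘v = ≼E-walk n u uE gap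
    in subst ((CoverE s k ⁼) u) (trans (↘⇒≡% z↘v (proj₂ vE)) (sym (↘⇒≡% z↘y y<s+k))) u≼v

lemma3p6 : (s k : ℕ) → 2 ≤ s → 1 ≤ k → Coprime s k →
    (x : ℕ) → InP s k x →
    (InDown s k x (x mod s) × InE s k (x mod s)) ×
    ((y : ℕ) → InDown s k x y → InE s k y →
      (x mod s) ≡ y ⊎ (x mod s) <E[ s , k ] y)
lemma3p6 (suc s′) k _ _ _ x (_ , x∉S) = (rDown , rE) , leastInE
  where
  s = suc s′
  open Gaps s k
  r = x % s
  x≡r+[x/s]s : x ≡ r + (x / s) * s
  x≡r+[x/s]s = m≡m%n+[m/n]*n x s
  gap : Gap (r + (x / s) * s)
  gap = subst Gap x≡r+[x/s]s x∉S
  rE : InE s k r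
  rE = Gap⇒InP (Gap-cancelʳ (*s∈S (x / s)) gap) , ≤-trans (m%n<n x s) (m≤m+n s k)
  rDown : InDown s k x r
  rDown = proj₁ rE , subst ((CoverP s k ⁼) r) (sym x≡r+[x/s]s) (+s-chain (x / s) r gap)
  leastInE : ∀ y → InDown s k x y → InE s k y → (CoverE s k ⁼) r y
  leastInE y (_ , y≼x) (_ , y<s+k) with ≼P⇒difference∈S y≼x
  ... | _ , (a , b , refl) , x≡y+z = ≼E-reach d r y rE y<s+k gap′ (b , sym y+b[s+k]≡r+ds)
    where
    d = x / s ∸ a
    y+b[s+k]+as≡x : y + b * (s + k) + a * s ≡ x
    y+b[s+k]+as≡x = sym (begin
      x                             ≡⟨ x≡y+z ⟩
      y + (a * s + b * (s + k))     ≡⟨ cong (y +_) (+-comm (a * s) (b * (s + k))) ⟩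
      y + (b * (s + k) + a * s)     ≡⟨ sym (+-assoc y _ _) ⟩
      y + b * (s + k) + a * s       ∎)
      where open ≡-Reasoning
    y+b[s+k]≡r+ds : y + b * (s + k) ≡ r + d * s
    y+b[s+k]≡r+ds = m+n*d≡o⇒m≡o%d+[o/d∸n]*d _ a x y+b[s+k]+as≡x
    r+ds+as≡x : r + d * s + a * s ≡ x
    r+ds+as≡x = trans (cong (_+ a * s) (sym y+b[s+k]≡r+ds)) y+b[s+k]+as≡x
    gap′ : Gap (r + d * s)
    gap′ = Gap-cancelʳ (*s∈S a) (subst Gap (sym r+ds+as≡x) x∉S)
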